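{- Let $G$ be a Cameron-Walker graph. If $G$ is vertex decomposable, then $\mathrm{Shed}(G)$ is a dominating set of $G$.
   Context: All graphs are finite and simple. A matching is a set of pairwise disjoint edges; the matching number is the maximum size of a matching. An induced matching is a matching $M$ such that the subgraph induced on the endpoints of $M$ has exactly the edges of $M$; the induced matching number is the maximum size of an induced matching. A graph is a Cameron-Walker graph if its induced matching number equals its matching number. For a graph $G=(V,E)$ and $x\in V$, $G\setminus x$ is the graph obtained by deleting $x$ and its incident edges; $N(x)$ is the set of neighbours of $x$, $N[x]=N(x)\cup\{x\}$, and $G\setminus N[x]$ is obtained by deleting all vertices of $N[x]$ and their incident edges. A graph is well-covered if all its maximal independent sets have the same cardinality. A graph $G$ is vertex decomposable if $G$ is well-covered and either (i) $G$ has no edges (possibly no vertices), or (ii) there is a vertex $x$ such that both $G\setminus x$ and $G\setminus N[x]$ are vertex decomposable. For a vertex decomposable graph $G$, $\mathrm{Shed}(G)$ is the set of vertices $x$ such that $G\setminus x$ and $G\setminus N[x]$ are both vertex decomposable. A set $D\subseteq V$ is dominating if every vertex of $V\setminus D$ is adjacent to a vertex of $D$. -}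

module Defs where

open import Data.Nat using (ℕ; _≤_)
open import Data.Fin using (Fin)
open import Data.Fin.Subset using (Subset; _∈_; _∉_; _⊆_; _∪_; _─_; _-_; ⁅_⁆; ∣_∣; ⊤)
open import Data.Vec using (tabulate)
open import Data.Bool using (Bool; true; false)
open import Data.Product using (Σ; ∃; _×_; _,_)
open import Data.Sum using (_⊎_)
open import Data.List using (List; []; _∷_; length; concatMap)
import Data.List.Membership.Propositional as LM
open import Data.List.Relation.Unary.All using (All)
open import Data.List.Relation.Unary.Unique.Propositional using (Unique)
open import Relation.Nullary using (¬_; Dec; yes; no)
open import Relation.Binary.PropositionalEquality using (_≡_)

record Graph (n : ℕ) : Set₁ where
  field
    E      : Fin n → Fin n → Set
    E-dec  : ∀ x y → Dec (E x y)
    E-sym  : ∀ {x y} → E x y → E y x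
    E-irr  : ∀ {x} → ¬ E x x

module _ {n : ℕ} (G : Graph n) where
  open Graph G

  -- Subgraphs obtained by deleting vertices are the induced subgraphs
  -- G[S] for S ⊆ V(G); we work with such vertex subsets S.

  N : Fin n → Subset n
  N x = tabulate (λ y → decide (E-dec x y))
    where
      decide : ∀ {P : Set} → Dec P → Bool
      decide (yes _) = true
      decide (no _)  = false

  N[_] : Fin n → Subset n
  N[ x ] = N x ∪ ⁅ x ⁆

  Independent : Subset n → Subset n → Set
  Independent S I = I ⊆ S × (∀ {x y} → x ∈ I → y ∈ I → ¬ E x y)

  MaximalIndependent : Subset n → Subset n → Set
  MaximalIndependent S I =
    Independent S I × (∀ J → Independent S J → I ⊆ J → J ⊆ I)

  WellCovered : Subset n → Set
  WellCovered S = ∀ I J → MaximalIndependent S I → MaximalIndependent S J →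
                  ∣ I ∣ ≡ ∣ J ∣

  HasNoEdges : Subset n → Set
  HasNoEdges S = ∀ {x y} → x ∈ S → y ∈ S → ¬ E x y

  data VertexDecomposable (S : Subset n) : Set where
    vd-noEdges : WellCovered S → HasNoEdges S → VertexDecomposable S
    vd-shed    : WellCovered S → (x : Fin n) → x ∈ S →
                 VertexDecomposable (S - x) →
                 VertexDecomposable (S ─ N[ x ]) →
                 VertexDecomposable S

  InShed : Subset n → Fin n → Set
  InShed S x = x ∈ S × VertexDecomposable (S - x) × VertexDecomposable (S ─ N[ x ])

  Edge : Set
  Edge = Σ (Fin n) (λ _ → Fin n)

  endpoints : List Edge → List (Fin n)
  endpoints = concatMap (λ { (a , b) → a ∷ b ∷ [] })

  IsMatching : Subset n → List Edge → Set
  IsMatching S M =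
    All (λ { (a , b) → a ∈ S × b ∈ S × E a b }) M × Unique (endpoints M)

  IsInducedMatching : Subset n → List Edge → Set
  IsInducedMatching S M = IsMatching S M ×
    (∀ {u v} → u LM.∈ endpoints M → v LM.∈ endpoints M → E u v →
       (u , v) LM.∈ M ⊎ (v , u) LM.∈ M)

  IsMatchingNumber : Subset n → ℕ → Set
  IsMatchingNumber S k =
    (∃ λ M → IsMatching S M × length M ≡ k) ×
    (∀ M → IsMatching S M → length M ≤ k)

  IsInducedMatchingNumber : Subset n → ℕ → Set
  IsInducedMatchingNumber S k =
    (∃ λ M → IsInducedMatching S M × length M ≡ k) ×
    (∀ M → IsInducedMatching S M → length M ≤ k)

  CameronWalker : Set
  CameronWalker = ∃ λ k → IsMatchingNumber ⊤ k × IsInducedMatchingNumber ⊤ k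

  IsDominating : (Fin n → Set) → Set
  IsDominating D = ∀ v → ¬ D v → ∃ λ x → D x × E v x

-- Let M be a maximum matching of G which is also induced.  For an edge ab of M,
-- if b has a second neighbour u′ then every neighbour of a other than b is u′:
-- a third neighbour u would let us replace ab by ua and bu′, and u, u′ are
-- unmatched because M is induced.  So one endpoint y of every edge xy of M is
-- a leaf at x or lies on a triangle xyz with no further neighbours, and such an
-- x is a shedding vertex with N(y) ⊆ N[x].  Since M is maximal, every
-- non-isolated vertex lies in or next to an edge of M, hence is in Shed(G) or
-- adjacent to it; an isolated vertex is always a shedding vertex.
module Submission where

open import Defs
open import Data.Nat using (ℕ; zero; suc; _≤_)
open import Data.Nat.Properties using (suc-injective; 1+n≰n)
open import Data.Fin using (Fin; zero; suc)
open import Data.Fin.Properties using (any?; _≟_)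
open import Data.Fin.Subset
  using (Subset; _∈_; _∉_; _⊆_; _∪_; _∩_; _─_; _-_; ⁅_⁆; ∣_∣; ⊤)
open import Data.Fin.Subset.Properties
  using (_∈?_; ⊆-antisym; ∪-identityʳ; x∈⁅x⁆; x∈⁅y⁆⇒x≡y; x∈p∪q⁻; x∈p∪q⁺; x∈p∩q⁻; x∈p∩q⁺;
         p─q⊆p; p─q─r≡p─q∪r; p─q─r≡p─r─q; p─x─y≡p─y─x; x∈p∧x∉q⇒x∈p─q; x∈p∧x≢y⇒x∈p-y; ∈⊤)
open import Data.Vec using (_∷_; here; there; lookup)
open import Data.Vec.Properties using (lookup∘tabulate; []=⇒lookup; lookup⇒[]=)
open import Data.Bool using (true; false)
open import Data.Product using (∃; ∃₂; _×_; _,_; proj₁; proj₂)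
open import Data.Sum as Sum using (_⊎_; inj₁; inj₂)
open import Data.Empty using (⊥; ⊥-elim)
open import Data.List using (List; []; _∷_; _++_; length; concatMap)
open import Data.List.Membership.Propositional using (find; lose)
  renaming (_∈_ to _∈ₗ_; _∉_ to _∉ₗ_)
open import Data.List.Membership.Propositional.Properties using (∈-∃++; ∈-concatMap⁺; ∈-concatMap⁻)
open import Data.List.Relation.Unary.Any using (here; there)
open import Data.List.Relation.Unary.All as All using (_∷_)
open import Data.List.Relation.Unary.All.Properties using (¬Any⇒All¬; All¬⇒¬Any)
open import Data.List.Relation.Unary.AllPairs using (_∷_)
open import Data.List.Relation.Unary.Unique.Propositional using (Unique)
open import Data.List.Relation.Binary.Permutation.Propositional as ↭
  using (_↭_; prep; swap; ↭-sym)
open import Data.List.Relation.Binary.Permutation.Propositional.Properties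
  using (All-resp-↭; ∈-resp-↭; ↭-length; ++⁺ˡ; shift; shifts)
open import Function using (_∘_)
open import Relation.Binary.Definitions using (_Respects_)
open import Relation.Nullary using (¬_; yes; no)
open import Relation.Nullary.Decidable using (_×-dec_; ¬?)
open import Relation.Binary.PropositionalEquality
  using (_≡_; _≢_; refl; sym; trans; cong; subst; ≢-sym; module ≡-Reasoning)

x∈p─q⇒x∉q : ∀ {n} {x : Fin n} (p q : Subset n) → x ∈ p ─ q → x ∉ q
x∈p─q⇒x∉q (s ∷ p) (true ∷ q) () here
x∈p─q⇒x∉q (true ∷ p) (false ∷ q) here ()
x∈p─q⇒x∉q (s ∷ p) (t ∷ q) (there x∈) (there x∈q) = x∈p─q⇒x∉q p q x∈ x∈q

∣p∪⁅x⁆∣≡1+∣p∣ : ∀ {n} (p : Subset n) {x} → x ∉ p → ∣ p ∪ ⁅ x ⁆ ∣ ≡ suc ∣ p ∣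
∣p∪⁅x⁆∣≡1+∣p∣ (true ∷ p) {zero} x∉p = ⊥-elim (x∉p here)
∣p∪⁅x⁆∣≡1+∣p∣ (false ∷ p) {zero} _ = cong (suc ∘ ∣_∣) (∪-identityʳ p)
∣p∪⁅x⁆∣≡1+∣p∣ (true ∷ p) {suc x} x∉p = cong suc (∣p∪⁅x⁆∣≡1+∣p∣ p (x∉p ∘ there))
∣p∪⁅x⁆∣≡1+∣p∣ (false ∷ p) {suc x} x∉p = ∣p∪⁅x⁆∣≡1+∣p∣ p (x∉p ∘ there)

module _ {n : ℕ} where

  x∈p-y⇒x≢y : ∀ {p : Subset n} {x y} → x ∈ p - y → x ≢ y
  x∈p-y⇒x≢y {p} {y = y} x∈ refl = x∈p─q⇒x∉q p ⁅ y ⁆ x∈ (x∈⁅x⁆ y)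

  x∈p∪⁅y⁆⁻ : ∀ {p : Subset n} {x y} → x ∈ p ∪ ⁅ y ⁆ → x ∈ p ⊎ x ≡ y
  x∈p∪⁅y⁆⁻ {p} {y = y} x∈ with x∈p∪q⁻ p ⁅ y ⁆ x∈
  ... | inj₁ x∈p = inj₁ x∈p
  ... | inj₂ x∈y = inj₂ (x∈⁅y⁆⇒x≡y y x∈y)

  p─q≡p : ∀ {p q : Subset n} → (∀ {x} → x ∈ p → x ∉ q) → p ─ q ≡ p
  p─q≡p {p} {q} disjoint = ⊆-antisym (p─q⊆p p q) (λ x∈p → x∈p∧x∉q⇒x∈p─q x∈p (disjoint x∈p))

  p-x─q≡p─q : ∀ (p q : Subset n) {x} → x ∈ q → p - x ─ q ≡ p ─ q
  p-x─q≡p─q p q {x} x∈q = begin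
    p - x ─ q  ≡⟨ p─q─r≡p─r─q p ⁅ x ⁆ q ⟩
    p ─ q - x  ≡⟨ p─q≡p (λ y∈ y∈x → x∈p─q⇒x∉q p q y∈ (subst (_∈ q) (sym (x∈⁅y⁆⇒x≡y x y∈x)) x∈q)) ⟩
    p ─ q      ∎
    where open ≡-Reasoning

module _ {a} {A : Set a} where

  ∉-∷⁺ : ∀ {x y : A} {ys} → x ≢ y → x ∉ₗ ys → x ∉ₗ y ∷ ys
  ∉-∷⁺ x≢y _ (here x≡y) = x≢y x≡y
  ∉-∷⁺ _ x∉ys (there x∈ys) = x∉ys x∈ys

  Unique-∷⁺ : ∀ {x : A} {xs} → x ∉ₗ xs → Unique xs → Unique (x ∷ xs)
  Unique-∷⁺ x∉xs unique = ¬Any⇒All¬ _ x∉xs ∷ unique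

  Unique-∷⁻ : ∀ {x : A} {xs} → Unique (x ∷ xs) → x ∉ₗ xs × Unique xs
  Unique-∷⁻ (x∉xs ∷ unique) = All¬⇒¬Any x∉xs , unique

  Unique-∷∷⇒∉ : ∀ {x y w : A} {zs} → Unique (x ∷ y ∷ zs) → w ≡ x ⊎ w ≡ y → w ∉ₗ zs
  Unique-∷∷⇒∉ unique (inj₁ refl) = proj₁ (Unique-∷⁻ unique) ∘ there
  Unique-∷∷⇒∉ (_ ∷ unique) (inj₂ refl) = proj₁ (Unique-∷⁻ unique)

  Unique-resp-↭ : Unique {A = A} Respects _↭_
  Unique-resp-↭ ↭.refl unique = unique
  Unique-resp-↭ (prep x σ) (x∉ ∷ unique) = All-resp-↭ σ x∉ ∷ Unique-resp-↭ σ unique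
  Unique-resp-↭ (swap x y σ) ((x≢y ∷ x∉) ∷ y∉ ∷ unique) =
    (≢-sym x≢y ∷ All-resp-↭ σ y∉) ∷ All-resp-↭ σ x∉ ∷ Unique-resp-↭ σ unique
  Unique-resp-↭ (↭.trans σ τ) = Unique-resp-↭ τ ∘ Unique-resp-↭ σ

  ∈⇒↭∷ : ∀ {x : A} {xs} → x ∈ₗ xs → ∃ λ ys → xs ↭ x ∷ ys
  ∈⇒↭∷ x∈xs with ys , zs , refl ← ∈-∃++ x∈xs = ys ++ zs , shift _ ys zs

  concatMap⁺-↭ : ∀ {b} {B : Set b} (f : A → List B) {xs ys} → xs ↭ ys → concatMap f xs ↭ concatMap f ys
  concatMap⁺-↭ f ↭.refl = ↭.refl
  concatMap⁺-↭ f (prep x σ) = ++⁺ˡ (f x) (concatMap⁺-↭ f σ)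
  concatMap⁺-↭ f (swap x y σ) = ↭.trans (++⁺ˡ (f x) (++⁺ˡ (f y) (concatMap⁺-↭ f σ))) (shifts (f x) (f y))
  concatMap⁺-↭ f (↭.trans σ τ) = ↭.trans (concatMap⁺-↭ f σ) (concatMap⁺-↭ f τ)

module _ {n : ℕ} (G : Graph n) where
  open Graph G
  open import Data.List.Membership.DecPropositional (_≟_ {n}) using () renaming (_∈?_ to _∈ₗ?_)

  VD : Subset n → Set
  VD = VertexDecomposable G

  -- G \ N[x] is the link of x in the independence complex.
  Link : Subset n → Fin n → Subset n
  Link S x = S ─ N[_] G x

  E⇒∈N : ∀ {x y} → E x y → y ∈ N G x
  E⇒∈N {x} {y} exy with E-dec x y | trans (refl {x = lookup (N G x) y}) (lookup∘tabulate _ y)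
  ... | yes _ | lookup≡true = lookup⇒[]= y _ lookup≡true
  ... | no ¬exy | _ = ⊥-elim (¬exy exy)

  ∈N⇒E : ∀ {x y} → y ∈ N G x → E x y
  ∈N⇒E {x} {y} y∈N with E-dec x y | trans (sym (lookup∘tabulate _ y)) ([]=⇒lookup y∈N)
  ... | yes exy | _ = exy
  ... | no _ | ()

  E⇒∈N[] : ∀ {x y} → E x y → y ∈ N[_] G x
  E⇒∈N[] exy = x∈p∪q⁺ (inj₁ (E⇒∈N exy))

  ∈Link⁻ : ∀ {S x w} → w ∈ Link S x → w ∈ S × w ≢ x × ¬ E x w
  ∈Link⁻ {S} {x} {w} w∈ =
    p─q⊆p S _ w∈ ,
    (λ { refl → w∉N[x] (x∈p∪q⁺ (inj₂ (x∈⁅x⁆ x))) }) ,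
    w∉N[x] ∘ E⇒∈N[]
    where
    w∉N[x] : w ∉ N[_] G x
    w∉N[x] = x∈p─q⇒x∉q S (N[_] G x) w∈

  ∈Link⁺ : ∀ {S x w} → w ∈ S → w ≢ x → ¬ E x w → w ∈ Link S x
  ∈Link⁺ {x = x} {w} w∈S w≢x ¬exw = x∈p∧x∉q⇒x∈p─q w∈S w∉N[x]
    where
    w∉N[x] : w ∉ N[_] G x
    w∉N[x] w∈ with x∈p∪⁅y⁆⁻ {p = N G x} w∈
    ... | inj₁ w∈N = ¬exw (∈N⇒E w∈N)
    ... | inj₂ w≡x = w≢x w≡x

  Link-isolated : ∀ {S x} → (∀ {w} → w ∈ S → ¬ E x w) → Link S x ≡ S - x
  Link-isolated {S} {x} isolated = begin
    S ─ (N G x ∪ ⁅ x ⁆)  ≡⟨ sym (p─q─r≡p─q∪r S (N G x) ⁅ x ⁆) ⟩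
    S ─ N G x - x        ≡⟨ cong (_- x) (p─q≡p (λ w∈S w∈N → isolated w∈S (∈N⇒E w∈N))) ⟩
    S - x                ∎
    where open ≡-Reasoning

  maximal-absorbs : ∀ {S T I J j} → MaximalIndependent G T I → Independent G S J →
                    I ⊆ J → j ∈ J → j ∈ T → j ∈ I
  maximal-absorbs {T = T} {J = J} ((I⊆T , _) , maximal) (_ , independentJ) I⊆J j∈J j∈T =
    maximal (J ∩ T) J∩T-independent (λ i∈I → x∈p∩q⁺ (I⊆J i∈I , I⊆T i∈I)) (x∈p∩q⁺ (j∈J , j∈T))
    where
    J∩T-independent : Independent G T (J ∩ T)
    J∩T-independent =
      (λ x∈ → proj₂ (x∈p∩q⁻ J _ x∈)) ,
      (λ x∈ y∈ → independentJ (proj₁ (x∈p∩q⁻ J _ x∈)) (proj₁ (x∈p∩q⁻ J _ y∈)))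

  independent-∪⁅⁆ : ∀ {T I y} → Independent G T I → y ∈ T → (∀ {i} → i ∈ I → ¬ E y i) →
                    Independent G T (I ∪ ⁅ y ⁆)
  independent-∪⁅⁆ {T} {I} {y} (I⊆T , independentI) y∈T y-free = ⊆T , independent
    where
    ⊆T : I ∪ ⁅ y ⁆ ⊆ T
    ⊆T x∈ with x∈p∪⁅y⁆⁻ {p = I} x∈
    ... | inj₁ x∈I = I⊆T x∈I
    ... | inj₂ refl = y∈T
    independent : ∀ {a b} → a ∈ I ∪ ⁅ y ⁆ → b ∈ I ∪ ⁅ y ⁆ → ¬ E a b
    independent a∈ b∈ with x∈p∪⁅y⁆⁻ {p = I} a∈ | x∈p∪⁅y⁆⁻ {p = I} b∈
    ... | inj₁ a∈I | inj₁ b∈I = independentI a∈I b∈I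
    ... | inj₁ a∈I | inj₂ refl = y-free a∈I ∘ E-sym
    ... | inj₂ refl | inj₁ b∈I = y-free b∈I
    ... | inj₂ refl | inj₂ refl = E-irr

  maximal-∋-free : ∀ {T I y} → MaximalIndependent G T I → y ∈ T → (∀ {i} → i ∈ I → ¬ E y i) → y ∈ I
  maximal-∋-free {y = y} (independentI , maximal) y∈T y-free =
    maximal _ (independent-∪⁅⁆ independentI y∈T y-free) (λ i∈I → x∈p∪q⁺ (inj₁ i∈I)) (x∈p∪q⁺ (inj₂ (x∈⁅x⁆ y)))

  maximal-lift : ∀ {S T I} → T ⊆ S → MaximalIndependent G T I →
                 (∀ J → Independent G S J → I ⊆ J → J ⊆ T) → MaximalIndependent G S I
  maximal-lift T⊆S maximalI@((I⊆T , independentI) , _) confined =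
    (T⊆S ∘ I⊆T , independentI) ,
    λ J independentJ I⊆J j∈J → maximal-absorbs maximalI independentJ I⊆J j∈J (confined J independentJ I⊆J j∈J)

  -- I ↦ I ∪ {x} maps the maximal independent sets of G \ N[x] into those of G.
  WC-link : ∀ {S x} → WellCovered G S → x ∈ S → WellCovered G (Link S x)
  WC-link {S} {x} wellCovered x∈S I J maximalI maximalJ = suc-injective (begin
    suc ∣ I ∣      ≡⟨ sym (∣p∪⁅x⁆∣≡1+∣p∣ I (x∉ maximalI)) ⟩
    ∣ I ∪ ⁅ x ⁆ ∣  ≡⟨ wellCovered _ _ (add-x maximalI) (add-x maximalJ) ⟩
    ∣ J ∪ ⁅ x ⁆ ∣  ≡⟨ ∣p∪⁅x⁆∣≡1+∣p∣ J (x∉ maximalJ) ⟩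
    suc ∣ J ∣      ∎)
    where
    open ≡-Reasoning
    x∉ : ∀ {K} → MaximalIndependent G (Link S x) K → x ∉ K
    x∉ ((K⊆ , _) , _) x∈K = proj₁ (proj₂ (∈Link⁻ (K⊆ x∈K))) refl
    add-x : ∀ {K} → MaximalIndependent G (Link S x) K → MaximalIndependent G S (K ∪ ⁅ x ⁆)
    add-x {K} maximalK@((K⊆ , independentK) , _) =
      independent-∪⁅⁆ (proj₁ ∘ ∈Link⁻ ∘ K⊆ , independentK) x∈S (proj₂ ∘ proj₂ ∘ ∈Link⁻ ∘ K⊆) ,
      absorbs
      where
      absorbs : ∀ L → Independent G S L → K ∪ ⁅ x ⁆ ⊆ L → L ⊆ K ∪ ⁅ x ⁆
      absorbs L (L⊆S , independentL) K+x⊆L {j} j∈L with j ≟ x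
      ... | yes refl = x∈p∪q⁺ (inj₂ (x∈⁅x⁆ x))
      ... | no j≢x = x∈p∪q⁺ (inj₁ (maximal-absorbs maximalK (L⊆S , independentL) (K+x⊆L ∘ x∈p∪q⁺ ∘ inj₁) j∈L
                      (∈Link⁺ (L⊆S j∈L) j≢x (independentL x∈L j∈L))))
        where
        x∈L : x ∈ L
        x∈L = K+x⊆L (x∈p∪q⁺ (inj₂ (x∈⁅x⁆ x)))

  -- Every maximal independent set of G \ x contains y, so it cannot be enlarged by x.
  WC-delete : ∀ {S x y} → WellCovered G S → y ∈ S → E x y →
              (∀ {w} → w ∈ S → E y w → w ≡ x ⊎ E x w) → WellCovered G (S - x)
  WC-delete {S} {x} {y} wellCovered y∈S exy N⊆N[x] I J maximalI maximalJ =
    wellCovered I J (lift maximalI) (lift maximalJ)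
    where
    lift : ∀ {K} → MaximalIndependent G (S - x) K → MaximalIndependent G S K
    lift {K} maximalK@((K⊆ , _) , _) = maximal-lift (p─q⊆p S _) maximalK confined
      where
      confined : ∀ L → Independent G S L → K ⊆ L → L ⊆ S - x
      confined L (L⊆S , independentL) K⊆L {j} j∈L with j ≟ x
      ... | no j≢x = x∈p∧x≢y⇒x∈p-y (L⊆S j∈L) j≢x
      ... | yes refl = ⊥-elim (independentL j∈L (K⊆L y∈K) exy)
        where
        y-free : ∀ {i} → i ∈ K → ¬ E y i
        y-free i∈K eyi with N⊆N[x] (p─q⊆p S _ (K⊆ i∈K)) eyi
        ... | inj₁ refl = x∈p-y⇒x≢y (K⊆ i∈K) refl
        ... | inj₂ exi = independentL j∈L (K⊆L i∈K) exi
        y∈K : y ∈ K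
        y∈K = maximal-∋-free maximalK (x∈p∧x≢y⇒x∈p-y y∈S λ { refl → E-irr exy }) y-free

  vd-isolated : ∀ {T y} → WellCovered G T → y ∈ T → (∀ {w} → w ∈ T → ¬ E y w) → VD (Link T y) → VD T
  vd-isolated wellCovered y∈T isolated vdLink =
    vd-shed wellCovered _ y∈T (subst VD (Link-isolated isolated) vdLink) vdLink

  VD-link : ∀ {S x} → VD S → x ∈ S → VD (Link S x)
  VD-link (vd-noEdges wellCovered noEdges) x∈S =
    vd-noEdges (WC-link wellCovered x∈S) (λ a∈ b∈ → noEdges (proj₁ (∈Link⁻ a∈)) (proj₁ (∈Link⁻ b∈)))
  VD-link {S} {x} (vd-shed wellCovered s s∈S vdDelete vdLink) x∈S with x ≟ s
  ... | yes refl = vdLink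
  ... | no x≢s with E-dec x s
  ...   | yes exs =
    subst VD (p-x─q≡p─q S (N[_] G x) (E⇒∈N[] exs)) (VD-link vdDelete (x∈p∧x≢y⇒x∈p-y x∈S x≢s))
  ...   | no ¬exs =
    vd-shed (WC-link wellCovered x∈S) s (∈Link⁺ s∈S (≢-sym x≢s) ¬exs)
      (subst VD (p─q─r≡p─r─q S ⁅ s ⁆ (N[_] G x)) (VD-link vdDelete (x∈p∧x≢y⇒x∈p-y x∈S x≢s)))
      (subst VD (p─q─r≡p─r─q S (N[_] G s) (N[_] G x)) (VD-link vdLink (∈Link⁺ x∈S x≢s (¬exs ∘ E-sym))))

  -- Within S, y is a leaf at x (z arbitrary), or y lies on a triangle xyz and has no other neighbours.
  LeafOrTriangle : Subset n → Fin n → Fin n → Fin n → Set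
  LeafOrTriangle S x y z = ∀ {w} → w ∈ S → E y w → w ≡ x ⊎ (w ≡ z × E x z)

  LeafOrTriangle-⊆ : ∀ {S T x y z} → T ⊆ S → LeafOrTriangle S x y z → LeafOrTriangle T x y z
  LeafOrTriangle-⊆ T⊆S leafOrTriangle w∈T = leafOrTriangle (T⊆S w∈T)

  LeafOrTriangle⇒N⊆N[] : ∀ {S x y z} → LeafOrTriangle S x y z → ∀ {w} → w ∈ S → E y w → w ≡ x ⊎ E x w
  LeafOrTriangle⇒N⊆N[] leafOrTriangle w∈S eyw with leafOrTriangle w∈S eyw
  ... | inj₁ w≡x = inj₁ w≡x
  ... | inj₂ (refl , exw) = inj₂ exw

  LeafOrTriangle⇒WC-delete : ∀ {S x y z} → WellCovered G S → y ∈ S → E x y → LeafOrTriangle S x y z →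
                             WellCovered G (S - x)
  LeafOrTriangle⇒WC-delete wellCovered y∈S exy leafOrTriangle =
    WC-delete wellCovered y∈S exy (LeafOrTriangle⇒N⊆N[] leafOrTriangle)

  -- y is the shedding vertex of S.  If z is a genuine neighbour of y, shed z from
  -- S \ x; otherwise y is isolated in S \ x.
  VD-delete-nextToShed : ∀ {S x y z} → VD S → VD (Link S y) → WellCovered G (S - x) → y ∈ S → E x y →
                         LeafOrTriangle S x y z → VD (S - x)
  VD-delete-nextToShed {S} {x} {y} {z} vd vdLink wellCovered y∈S exy leafOrTriangle
    with (z ∈? S) ×-dec E-dec y z ×-dec ¬? (z ≟ x)
  ... | yes (z∈S , eyz , z≢x) = vd-shed wellCovered z (x∈p∧x≢y⇒x∈p-y z∈S z≢x) vdDelete-z vdLink-z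
    where
    exz : E x z
    exz with leafOrTriangle z∈S eyz
    ... | inj₁ z≡x = ⊥-elim (z≢x z≡x)
    ... | inj₂ (_ , exz) = exz
    vdLink-z : VD (Link (S - x) z)
    vdLink-z = subst VD (sym (p-x─q≡p─q S (N[_] G z) (E⇒∈N[] (E-sym exz)))) (VD-link vd z∈S)
    y∈S-x-z : y ∈ S - x - z
    y∈S-x-z = x∈p∧x≢y⇒x∈p-y (x∈p∧x≢y⇒x∈p-y y∈S λ { refl → E-irr exy }) λ { refl → E-irr eyz }
    only-z : ∀ {w} → w ∈ S - x → E y w → w ≡ z
    only-z w∈ eyw with leafOrTriangle (p─q⊆p S _ w∈) eyw
    ... | inj₁ w≡x = ⊥-elim (x∈p-y⇒x≢y w∈ w≡x)
    ... | inj₂ (w≡z , _) = w≡z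
    link-y : Link (S - x - z) y ≡ Link S y
    link-y = trans (p-x─q≡p─q (S - x) (N[_] G y) (E⇒∈N[] eyz)) (p-x─q≡p─q S (N[_] G y) (E⇒∈N[] (E-sym exy)))
    vdDelete-z : VD (S - x - z)
    vdDelete-z =
      vd-isolated (WC-delete wellCovered (p─q⊆p _ _ y∈S-x-z) (E-sym eyz) (λ w∈ eyw → inj₁ (only-z w∈ eyw)))
        y∈S-x-z (λ w∈ eyw → x∈p-y⇒x≢y w∈ (only-z (p─q⊆p _ _ w∈) eyw)) (subst VD (sym link-y) vdLink)
  ... | no ¬z-neighbour =
    vd-isolated wellCovered (x∈p∧x≢y⇒x∈p-y y∈S λ { refl → E-irr exy }) isolated
      (subst VD (sym (p-x─q≡p─q S (N[_] G y) (E⇒∈N[] (E-sym exy)))) vdLink)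
    where
    isolated : ∀ {w} → w ∈ S - x → ¬ E y w
    isolated w∈ eyw with leafOrTriangle (p─q⊆p S _ w∈) eyw
    ... | inj₁ w≡x = x∈p-y⇒x≢y w∈ w≡x
    ... | inj₂ (refl , _) = ¬z-neighbour (p─q⊆p S _ w∈ , eyw , x∈p-y⇒x≢y w∈)

  VD-delete : ∀ {S x y z} → VD S → x ∈ S → y ∈ S → E x y → LeafOrTriangle S x y z → VD (S - x)
  VD-delete (vd-noEdges _ noEdges) x∈S y∈S exy _ = ⊥-elim (noEdges x∈S y∈S exy)
  VD-delete {S} {x} {y} {z} vd@(vd-shed wellCovered s s∈S vdDelete vdLink) x∈S y∈S exy leafOrTriangle
    with s ≟ x | s ≟ y
  ... | yes refl | _ = vdDelete
  ... | no _ | yes refl =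
    VD-delete-nextToShed vd vdLink (LeafOrTriangle⇒WC-delete wellCovered y∈S exy leafOrTriangle) y∈S exy leafOrTriangle
  ... | no s≢x | no s≢y =
    vd-shed (LeafOrTriangle⇒WC-delete wellCovered y∈S exy leafOrTriangle) s (x∈p∧x≢y⇒x∈p-y s∈S s≢x) vdDelete-s vdLink-s
    where
    vdDelete-s : VD (S - x - s)
    vdDelete-s = subst VD (p─x─y≡p─y─x S s x)
      (VD-delete vdDelete (x∈p∧x≢y⇒x∈p-y x∈S (≢-sym s≢x)) (x∈p∧x≢y⇒x∈p-y y∈S (≢-sym s≢y)) exy
        (LeafOrTriangle-⊆ (p─q⊆p S _) leafOrTriangle))
    vdLink-s : VD (Link (S - x) s)
    vdLink-s with E-dec s x
    ... | yes esx = subst VD (sym (p-x─q≡p─q S (N[_] G s) (E⇒∈N[] esx))) vdLink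
    ... | no ¬esx = subst VD (p─q─r≡p─r─q S (N[_] G s) ⁅ x ⁆)
      (VD-delete vdLink (∈Link⁺ x∈S (≢-sym s≢x) ¬esx) (∈Link⁺ y∈S (≢-sym s≢y) ¬esy) exy
        (LeafOrTriangle-⊆ (p─q⊆p S _) leafOrTriangle))
      where
      ¬esy : ¬ E s y
      ¬esy esy with leafOrTriangle s∈S (E-sym esy)
      ... | inj₁ s≡x = s≢x s≡x
      ... | inj₂ (s≡z , exz) = ¬esx (E-sym (subst (E x) (sym s≡z) exz))

  isolated⇒InShed : ∀ {S x} → VD S → x ∈ S → (∀ {w} → w ∈ S → ¬ E x w) → InShed G S x
  isolated⇒InShed vd x∈S isolated = x∈S , subst VD (Link-isolated isolated) (VD-link vd x∈S) , VD-link vd x∈S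

  ShedEdge : Subset n → Fin n → Fin n → Set
  ShedEdge S x y = InShed G S x × E x y × (∀ {w} → w ∈ S → E y w → w ≡ x ⊎ E x w)

  leafOrTriangle⇒ShedEdge : ∀ {S x y z} → VD S → x ∈ S → y ∈ S → E x y →
                            LeafOrTriangle S x y z → ShedEdge S x y
  leafOrTriangle⇒ShedEdge vd x∈S y∈S exy leafOrTriangle =
    (x∈S , VD-delete vd x∈S y∈S exy leafOrTriangle , VD-link vd x∈S) , exy , LeafOrTriangle⇒N⊆N[] leafOrTriangle

  shedEdge-dominates : ∀ {S x y v} → ¬ InShed G S v → v ∈ S → ShedEdge S x y →
                       (v ≡ x ⊎ E v x) ⊎ (v ≡ y ⊎ E v y) → ∃ λ s → InShed G S s × E v s
  shedEdge-dominates v∉Shed _ (x∈Shed , _) (inj₁ (inj₁ refl)) = ⊥-elim (v∉Shed x∈Shed)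
  shedEdge-dominates _ _ (x∈Shed , _) (inj₁ (inj₂ evx)) = _ , x∈Shed , evx
  shedEdge-dominates _ _ (x∈Shed , exy , _) (inj₂ (inj₁ refl)) = _ , x∈Shed , E-sym exy
  shedEdge-dominates v∉Shed v∈S (x∈Shed , _ , N⊆N[x]) (inj₂ (inj₂ evy)) with N⊆N[x] v∈S (E-sym evy)
  ... | inj₁ refl = ⊥-elim (v∉Shed x∈Shed)
  ... | inj₂ exv = _ , x∈Shed , E-sym exv

  ends : List (Edge G) → List (Fin n)
  ends = endpoints G

  ∈-ends⁺ : ∀ {M a b v} → (a , b) ∈ₗ M → v ≡ a ⊎ v ≡ b → v ∈ₗ ends M
  ∈-ends⁺ {a = a} {b} {v} ab∈M v∈ab = ∈-concatMap⁺ _ (lose ab∈M (endpoint v∈ab))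
    where
    endpoint : v ≡ a ⊎ v ≡ b → v ∈ₗ a ∷ b ∷ []
    endpoint (inj₁ v≡a) = here v≡a
    endpoint (inj₂ v≡b) = there (here v≡b)

  ∈-ends⁻ : ∀ {M v} → v ∈ₗ ends M → ∃₂ λ a b → (a , b) ∈ₗ M × (v ≡ a ⊎ v ≡ b)
  ∈-ends⁻ {M} v∈ with find (∈-concatMap⁻ (λ e → proj₁ e ∷ proj₂ e ∷ []) {xs = M} v∈)
  ... | (a , b) , ab∈M , here v≡a = a , b , ab∈M , inj₁ v≡a
  ... | (a , b) , ab∈M , there (here v≡b) = a , b , ab∈M , inj₂ v≡b

  IsMaximum : Subset n → List (Edge G) → Set
  IsMaximum S M = ∀ M′ → IsMatching G S M′ → length M′ ≤ length M

  matching-resp-↭ : ∀ {S M M′} → M ↭ M′ → IsMatching G S M → IsMatching G S M′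
  matching-resp-↭ σ (edges , unique) = All-resp-↭ σ edges , Unique-resp-↭ (concatMap⁺-↭ _ σ) unique

  matching-∷ : ∀ {S M v w} → IsMatching G S M → v ∈ S → w ∈ S → E v w →
               v ∉ₗ ends M → w ∉ₗ ends M → IsMatching G S ((v , w) ∷ M)
  matching-∷ (edges , unique) v∈S w∈S evw v∉ w∉ =
    (v∈S , w∈S , evw) ∷ edges ,
    Unique-∷⁺ (∉-∷⁺ (λ { refl → E-irr evw }) v∉) (Unique-∷⁺ w∉ unique)

  -- Exchanging ab for au and bu′ augments M.
  matching-reroute : ∀ {S M a b u u′} → IsMatching G S M → (a , b) ∈ₗ M → u ∈ S → u′ ∈ S →
                     E a u → E b u′ → u ≢ u′ → u ∉ₗ ends M → u′ ∉ₗ ends M →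
                     ∃ λ M′ → IsMatching G S M′ × length M′ ≡ suc (length M)
  matching-reroute {M = M} {a = a} {b} {u} {u′} matching ab∈M u∈S u′∈S eau ebu′ u≢u′ u∉ u′∉
    with M₀ , σ ← ∈⇒↭∷ ab∈M
    with ((a∈S , b∈S , eab) ∷ edges₀) , unique ← matching-resp-↭ σ matching =
    (u′ , b) ∷ (a , u) ∷ M₀ ,
    matching-∷ (matching-∷ (edges₀ , unique₀) a∈S u∈S eau a∉₀ (u∉ ∘ ⊆ends))
      u′∈S b∈S (E-sym ebu′) (∉-∷⁺ (λ { refl → u′∉ a∈ends }) (∉-∷⁺ (≢-sym u≢u′) (u′∉ ∘ ⊆ends)))
      (∉-∷⁺ (λ { refl → E-irr eab }) (∉-∷⁺ (λ { refl → u∉ b∈ends }) b∉₀)) ,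
    cong suc (sym (↭-length σ))
    where
    a∉₀ : a ∉ₗ ends M₀
    a∉₀ = Unique-∷∷⇒∉ unique (inj₁ refl)
    b∉₀ : b ∉ₗ ends M₀
    b∉₀ = Unique-∷∷⇒∉ unique (inj₂ refl)
    unique₀ : Unique (ends M₀)
    unique₀ = proj₂ (Unique-∷⁻ (proj₂ (Unique-∷⁻ unique)))
    ⊆ends : ∀ {w} → w ∈ₗ ends M₀ → w ∈ₗ ends M
    ⊆ends w∈ = ∈-resp-↭ (concatMap⁺-↭ _ (↭-sym σ)) (there (there w∈))
    a∈ends : a ∈ₗ ends M
    a∈ends = ∈-ends⁺ ab∈M (inj₁ refl)
    b∈ends : b ∈ₗ ends M
    b∈ends = ∈-ends⁺ ab∈M (inj₂ refl)

  matching-edge : ∀ {S M a b} → IsMatching G S M → (a , b) ∈ₗ M → a ∈ S × b ∈ S × E a b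
  matching-edge (edges , _) = All.lookup edges

  inducedMatching-neighbour∉ : ∀ {S M a b p u} → IsInducedMatching G S M → (a , b) ∈ₗ M →
                               p ≡ a ⊎ p ≡ b → E p u → u ≢ a → u ≢ b → u ∉ₗ ends M
  inducedMatching-neighbour∉ {M = M} {a = a} {b} {p} ((_ , unique) , induced) ab∈M p∈ab epu u≢a u≢b u∈ends =
    Sum.[ (λ pu∈M → excluded pu∈M (u≢b ∘ cong proj₂) (inj₁ refl))
        , (λ up∈M → excluded up∈M (u≢a ∘ cong proj₁) (inj₂ refl)) ]
      (induced (∈-ends⁺ ab∈M p∈ab) u∈ends epu)
    where
    M₀ : List (Edge G)
    M₀ = proj₁ (∈⇒↭∷ ab∈M)
    σ : M ↭ (a , b) ∷ M₀
    σ = proj₂ (∈⇒↭∷ ab∈M)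
    p∉₀ : p ∉ₗ ends M₀
    p∉₀ = Unique-∷∷⇒∉ (Unique-resp-↭ (concatMap⁺-↭ _ σ) unique) p∈ab
    excluded : ∀ {c d} → (c , d) ∈ₗ M → (c , d) ≢ (a , b) → p ≡ c ⊎ p ≡ d → ⊥
    excluded cd∈M cd≢ab p∈cd with ∈-resp-↭ σ cd∈M
    ... | here cd≡ab = cd≢ab cd≡ab
    ... | there cd∈M₀ = p∉₀ (∈-ends⁺ cd∈M₀ p∈cd)

  ¬augmenting : ∀ {S} M {M′} → IsMaximum S M → IsMatching G S M′ → length M′ ≢ suc (length M)
  ¬augmenting _ maximum matching′ longer = 1+n≰n (subst (_≤ _) longer (maximum _ matching′))

  maximumMatching-near : ∀ {S M v w} → IsMatching G S M → IsMaximum S M → v ∈ S → w ∈ S → E v w →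
                         ∃₂ λ a b → (a , b) ∈ₗ M × ((v ≡ a ⊎ E v a) ⊎ (v ≡ b ⊎ E v b))
  maximumMatching-near {M = M} {v} {w} matching maximum v∈S w∈S evw with v ∈ₗ? ends M | w ∈ₗ? ends M
  ... | yes v∈ends | _ with a , b , ab∈M , v∈ab ← ∈-ends⁻ v∈ends =
    a , b , ab∈M , Sum.map inj₁ inj₁ v∈ab
  ... | no _ | yes w∈ends with a , b , ab∈M , w∈ab ← ∈-ends⁻ w∈ends =
    a , b , ab∈M , Sum.map (λ w≡a → inj₂ (subst (E v) w≡a evw)) (λ w≡b → inj₂ (subst (E v) w≡b evw)) w∈ab
  ... | no v∉ends | no w∉ends =
    ⊥-elim (¬augmenting M maximum (matching-∷ matching v∈S w∈S evw v∉ends w∉ends) refl)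

  -- A neighbour u of a outside {b, u′} would give the augmenting exchange of matching-reroute.
  inducedMaximum-leafOrTriangle : ∀ {S M a b} → IsInducedMatching G S M → IsMaximum S M → (a , b) ∈ₗ M →
                                  ∃ λ z → LeafOrTriangle S a b z ⊎ LeafOrTriangle S b a z
  inducedMaximum-leafOrTriangle {S} {M} {a} {b} induced maximum ab∈M
    with any? (λ w → (w ∈? S) ×-dec E-dec b w ×-dec ¬? (w ≟ a))
  ... | no ¬second = b , inj₁ leaf
    where
    leaf : LeafOrTriangle S a b b
    leaf {w} w∈S ebw with w ≟ a
    ... | yes w≡a = inj₁ w≡a
    ... | no w≢a = ⊥-elim (¬second (w , w∈S , ebw , w≢a))
  ... | yes (u′ , u′∈S , ebu′ , u′≢a) = u′ , inj₂ triangle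
    where
    triangle : LeafOrTriangle S b a u′
    triangle {w} w∈S eaw with w ≟ b | w ≟ u′
    ... | yes w≡b | _ = inj₁ w≡b
    ... | no _ | yes w≡u′ = inj₂ (w≡u′ , ebu′)
    ... | no w≢b | no w≢u′ with M′ , matching′ , longer ←
      matching-reroute (proj₁ induced) ab∈M w∈S u′∈S eaw ebu′ w≢u′
        (inducedMatching-neighbour∉ induced ab∈M (inj₁ refl) eaw (λ { refl → E-irr eaw }) w≢b)
        (inducedMatching-neighbour∉ induced ab∈M (inj₂ refl) ebu′ u′≢a (λ { refl → E-irr ebu′ }))
      = ⊥-elim (¬augmenting M maximum matching′ longer)

  matchedEdge-shed : ∀ {S M a b} → VD S → IsInducedMatching G S M → IsMaximum S M → (a , b) ∈ₗ M →
                     ShedEdge S a b ⊎ ShedEdge S b a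
  matchedEdge-shed vd induced maximum ab∈M
    with matching-edge (proj₁ induced) ab∈M | inducedMaximum-leafOrTriangle induced maximum ab∈M
  ... | a∈S , b∈S , eab | _ , inj₁ leafOrTriangle = inj₁ (leafOrTriangle⇒ShedEdge vd a∈S b∈S eab leafOrTriangle)
  ... | a∈S , b∈S , eab | _ , inj₂ leafOrTriangle =
    inj₂ (leafOrTriangle⇒ShedEdge vd b∈S a∈S (E-sym eab) leafOrTriangle)

  cameronWalker⇒maximumInducedMatching : CameronWalker G → ∃ λ M → IsInducedMatching G ⊤ M × IsMaximum ⊤ M
  cameronWalker⇒maximumInducedMatching (_ , (_ , bounded) , ((M , induced , refl) , _)) = M , induced , bounded

corollary3p2 : {n : ℕ} (G : Graph n) → CameronWalker G →
    VertexDecomposable G ⊤ → IsDominating G (InShed G ⊤)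
corollary3p2 G cameronWalker vd v v∉Shed with any? (Graph.E-dec G v)
... | no isolated = ⊥-elim (v∉Shed (isolated⇒InShed G vd ∈⊤ (λ _ evw → isolated (_ , evw))))
... | yes (_ , evw)
  with M , induced , maximum ← cameronWalker⇒maximumInducedMatching G cameronWalker
  with a , b , ab∈M , near ← maximumMatching-near G (proj₁ induced) maximum ∈⊤ ∈⊤ evw
  with matchedEdge-shed G vd induced maximum ab∈M
... | inj₁ shedEdge = shedEdge-dominates G v∉Shed ∈⊤ shedEdge near
... | inj₂ shedEdge = shedEdge-dominates G v∉Shed ∈⊤ shedEdge (Sum.swap near)
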